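{- Let $Z \subseteq \overline{\mathbb{F}}$ be a floating-point interval, let $x, y \in \mathbb{F}^*$ and $z \in Z$. If $|z/x| > \max\mathbb{F}$, $x$ is not feasible for $Z$, and $|y| \le |x|$, then $y$ is not feasible for $Z$.
   Context: Floating-point format: integers $\beta \ge 2$, $p \ge 1$, $e_{\min} \le e_{\max}$. $\mathbb{F}^* = \{M\beta^{e-p+1} : M,e \in \mathbb{Z},\ 0<|M|<\beta^p,\ e_{\min}\le e\le e_{\max}\}$, $\mathbb{F} = \mathbb{F}^*\cup\{0\}$, $\overline{\mathbb{F}} = \mathbb{F}\cup\{ -\infty,+\infty\}$. $\mathrm{RD}(x) = \max\{y\in\overline{\mathbb{F}} : y \le x\}$, $\mathrm{RU}(x) = \min\{y \in \overline{\mathbb{F}} : y \ge x\}$. $\mathrm{fl}:\overline{\mathbb{R}}\to\overline{\mathbb{F}}$ is a fixed nondecreasing rounding function with $\mathrm{fl}(x)\in\{\mathrm{RD}(x),\mathrm{RU}(x)\}$ for all $x$; $x\otimes y = \mathrm{fl}(xy)$ whenever the extended-real product is defined. A floating-point interval is a set $X\cap\overline{\mathbb{F}}$ with $X$ an extended-real interval. $x$ is feasible for $Z$ if $x\otimes w\in Z$ for some $w\in\overline{\mathbb{F}}$. -}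

module Defs where

open import Data.Nat as ℕ using (ℕ; suc)
open import Data.Nat.Properties as ℕP using ()
open import Data.Integer as ℤ using (ℤ; +_; -[1+_])
open import Data.Rational as ℚ using (ℚ; 0ℚ; 1ℚ; _/_; _<_; _≤_; _*_; _÷_; ∣_∣)
open import Data.Rational.Properties as ℚP using (_≟_)
open import Data.Maybe using (Maybe; just; nothing)
open import Data.Product using (Σ; ∃; _×_; _,_)
open import Data.Sum using (_⊎_)
open import Data.Empty using (⊥)
open import Data.Unit using (⊤)
open import Relation.Nullary using (yes; no)
open import Relation.Binary.PropositionalEquality using (_≡_)

-- Extended rationals  ℚ ∪ {-∞, +∞}.  All floating-point numbers and all
-- (defined) products of floating-point numbers lie here.

data ℚ̄ : Set where
  -∞  : ℚ̄
  fin : ℚ → ℚ̄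
  +∞  : ℚ̄

infix 4 _≤̄_ _<̄_
data _≤̄_ : ℚ̄ → ℚ̄ → Set where
  -∞≤   : ∀ {a} → -∞ ≤̄ a
  ≤+∞   : ∀ {a} → a ≤̄ +∞
  fin≤  : ∀ {a b} → a ≤ b → fin a ≤̄ fin b

data _<̄_ : ℚ̄ → ℚ̄ → Set where
  -∞<fin : ∀ {a} → -∞ <̄ fin a
  -∞<+∞  : -∞ <̄ +∞
  fin<+∞ : ∀ {a} → fin a <̄ +∞
  fin<   : ∀ {a b} → a < b → fin a <̄ fin b

∣_∣̄ : ℚ̄ → ℚ̄
∣ -∞ ∣̄    = +∞
∣ fin a ∣̄ = fin ∣ a ∣
∣ +∞ ∣̄    = +∞

data Sign : Set where neg zer pos : Sign

sign : ℚ → Sign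
sign q with q ℚ.<? 0ℚ
... | yes _ = neg
... | no _ with q ≟ 0ℚ
...   | yes _ = zer
...   | no _  = pos

negS : Sign → Sign
negS neg = pos
negS zer = zer
negS pos = neg

infOf : Sign → Maybe ℚ̄
infOf neg = just -∞
infOf zer = nothing
infOf pos = just +∞

-- extended-real product (partial: undefined for 0·(±∞))
_·̄_ : ℚ̄ → ℚ̄ → Maybe ℚ̄
fin a ·̄ fin b = just (fin (a * b))
+∞    ·̄ fin b = infOf (sign b)
-∞    ·̄ fin b = infOf (negS (sign b))
fin a ·̄ +∞    = infOf (sign a)
fin a ·̄ -∞    = infOf (negS (sign a))
+∞    ·̄ +∞    = just +∞
-∞    ·̄ -∞    = just +∞
+∞    ·̄ -∞    = just -∞
-∞    ·̄ +∞    = just -∞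

-- rational division, total (returns 0 when the divisor is 0; only used
-- with nonzero divisors)
_÷'_ : ℚ → ℚ → ℚ
p ÷' q with q ≟ 0ℚ
... | yes _  = 0ℚ
... | no q≢0 = _÷_ p q {{ℚ.≢-nonZero q≢0}}

_/̄_ : ℚ̄ → ℚ → ℚ̄
fin a /̄ x = fin (a ÷' x)
+∞    /̄ x with sign x
... | neg = -∞
... | _   = +∞
-∞    /̄ x with sign x
... | neg = +∞
... | _   = -∞

record Format : Set where
  field
    β    : ℕ
    p    : ℕ
    emin : ℤ
    emax : ℤ
    2≤β  : 2 ℕ.≤ β
    1≤p  : 1 ℕ.≤ p
    emin≤emax : emin ℤ.≤ emax

  instance
    β-nonZero : ℕ.NonZero β
    β-nonZero = ℕ.>-nonZero (ℕP.≤-trans (ℕ.s≤s ℕ.z≤n) 2≤β)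

  βpow : ℤ → ℚ
  βpow (+ n)    = (+ (β ℕ.^ n)) / 1
  βpow -[1+ n ] = _/_ (+ 1) (β ℕ.^ suc n) {{ℕP.m^n≢0 β (suc n)}}

  IsF* : ℚ → Set
  IsF* q = Σ ℤ λ M → Σ ℤ λ e →
             (0 ℕ.< ℤ.∣ M ∣) × (ℤ.∣ M ∣ ℕ.< β ℕ.^ p) ×
             (emin ℤ.≤ e) × (e ℤ.≤ emax) ×
             (q ≡ (M / 1) * βpow (e ℤ.- (+ p) ℤ.+ (+ 1)))

  IsF : ℚ → Set
  IsF q = IsF* q ⊎ q ≡ 0ℚ

  IsF̄ : ℚ̄ → Set
  IsF̄ -∞      = ⊤
  IsF̄ (fin q) = IsF q
  IsF̄ +∞      = ⊤

  maxF : ℚ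
  maxF = ((+ (β ℕ.^ p) ℤ.- + 1) / 1) * βpow (emax ℤ.- (+ p) ℤ.+ (+ 1))

  IsRD : ℚ̄ → ℚ̄ → Set
  IsRD x y = IsF̄ y × y ≤̄ x × (∀ w → IsF̄ w → w ≤̄ x → w ≤̄ y)

  IsRU : ℚ̄ → ℚ̄ → Set
  IsRU x y = IsF̄ y × x ≤̄ y × (∀ w → IsF̄ w → x ≤̄ w → y ≤̄ w)

  record IsRounding (fl : ℚ̄ → ℚ̄) : Set where
    field
      mono   : ∀ a b → a ≤̄ b → fl a ≤̄ fl b
      faithful : ∀ a → IsRD a (fl a) ⊎ IsRU a (fl a)

  IsInterval : (ℚ̄ → Set) → Set
  IsInterval X = ∀ a b c → X a → X c → a ≤̄ b → b ≤̄ c → X b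

  FPInterval : (ℚ̄ → Set) → ℚ̄ → Set
  FPInterval X a = IsF̄ a × X a

  Feasible : (ℚ̄ → ℚ̄) → (ℚ̄ → Set) → ℚ̄ → Set
  Feasible fl Z x = Σ ℚ̄ λ w → IsF̄ w × Σ ℚ̄ λ r → (x ·̄ w ≡ just r) × Z (fl r)

-- Suppose y ⊗ w ∈ Z.  If y·w = ±∞, then also x·(±∞) = ±∞ for a suitable
-- sign, and if z = ±∞ then fl(z) = z; either way x would be feasible.
-- Otherwise y·w and z are finite and, with t = ∣x w∣,
-- ∣y w∣ ≤ t ≤ ∣x∣ max 𝔽 < ∣z∣.  Hence one of 0, t, −t lies between y w and z,
-- and each of them is x w′ for some w′ ∈ {0, w, −w} ⊆ 𝔽.  Since fl is
-- monotone and Z is an interval, fl(x w′) ∈ Z: x would be feasible.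
module Submission where

open import Defs
open import Data.Rational using (ℚ; ∣_∣; _≤_)
open import Relation.Nullary using (¬_)

open import Data.Empty using (⊥-elim)
open import Data.Integer as ℤ using (ℤ; +_; -[1+_]; +[1+_])
import Data.Integer.Properties as ℤP
open import Data.Maybe using (just)
open import Data.Nat as ℕ using (suc; _∸_)
import Data.Nat.Properties as ℕP
open import Data.Product using (Σ; _×_; _,_)
open import Data.Rational using (0ℚ; 1ℚ; _/_; _<_; _*_; -_; 1/_; Positive; nonNegative; ≢-nonZero)
open import Data.Rational.Properties
import Data.Rational.Unnormalised as ℚᵘ
import Data.Rational.Unnormalised.Properties as ℚᵘP
open import Data.Sum using (_⊎_; inj₁; inj₂)
open import Data.Unit using (tt)
open import Relation.Binary.PropositionalEquality
open import Relation.Nullary using (yes; no; contradiction)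
open import Algebra.Properties.Group +-0-group using ()
  renaming (⁻¹-involutive to neg-involutive)

+n-+1≡+[n∸1] : ∀ {n} → 1 ℕ.≤ n → + n ℤ.- + 1 ≡ + (n ∸ 1)
+n-+1≡+[n∸1] {n} 1≤n = trans (ℤP.m-n≡m⊖n n 1) (ℤP.⊖-≥ 1≤n)

+a/b≤+c/d : ∀ a b c d .{{_ : ℕ.NonZero b}} .{{_ : ℕ.NonZero d}} →
            a ℕ.* d ℕ.≤ c ℕ.* b → + a / b ≤ + c / d
+a/b≤+c/d a (suc b) c (suc d) ad≤cb = toℚᵘ-cancel-≤
  (ℚᵘP.≤-respʳ-≃ (ℚᵘP.≃-sym (toℚᵘ-fromℚᵘ (ℚᵘ.mkℚᵘ (+ c) d)))
  (ℚᵘP.≤-respˡ-≃ (ℚᵘP.≃-sym (toℚᵘ-fromℚᵘ (ℚᵘ.mkℚᵘ (+ a) b)))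
  (ℚᵘ.*≤* (subst₂ ℤ._≤_ (ℤP.pos-* a (suc d)) (ℤP.pos-* c (suc b)) (ℤ.+≤+ ad≤cb)))))

-[i/1]≡-i/1 : ∀ i → - (i / 1) ≡ ℤ.- i / 1
-[i/1]≡-i/1 (+ 0)    = refl
-[i/1]≡-i/1 +[1+ n ] = refl
-[i/1]≡-i/1 -[1+ n ] = neg-involutive _

∣i/1∣≡∣i∣/1 : ∀ i → ∣ i / 1 ∣ ≡ + ℤ.∣ i ∣ / 1
∣i/1∣≡∣i∣/1 (+ n)    = 0≤p⇒∣p∣≡p (nonNegative⁻¹ _ {{normalize-nonNeg n 1}})
∣i/1∣≡∣i∣/1 -[1+ n ] = trans (∣-p∣≡∣p∣ _) (∣i/1∣≡∣i∣/1 (+ suc n))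

p≤0⇒-∣p∣≡p : ∀ {p} → p ≤ 0ℚ → - ∣ p ∣ ≡ p
p≤0⇒-∣p∣≡p {p} p≤0 = begin
  - ∣ p ∣     ≡⟨ cong -_ (∣-p∣≡∣p∣ p) ⟨
  - ∣ - p ∣   ≡⟨ cong -_ (0≤p⇒∣p∣≡p (neg-antimono-≤ p≤0)) ⟩
  - (- p)     ≡⟨ neg-involutive p ⟩
  p           ∎
  where open ≡-Reasoning

∣p∣>0⇒p≢0 : ∀ {p} → Positive ∣ p ∣ → p ≢ 0ℚ
∣p∣>0⇒p≢0 ∣p∣>0 refl = <-irrefl refl (positive⁻¹ ∣ 0ℚ ∣ {{∣p∣>0}})

÷'-*-cancel : ∀ z {x} → x ≢ 0ℚ → (z ÷' x) * x ≡ z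
÷'-*-cancel z {x} x≢0 with x ≟ 0ℚ
... | yes x≡0 = contradiction x≡0 x≢0
... | no x≢0′ = begin
  z * 1/ x * x     ≡⟨ *-assoc z (1/ x) x ⟩
  z * (1/ x * x)   ≡⟨ cong (z *_) (*-inverseˡ x) ⟩
  z * 1ℚ           ≡⟨ *-identityʳ z ⟩
  z                ∎
  where open ≡-Reasoning; instance _ = ≢-nonZero x≢0′

∣x∣*m<∣z∣ : ∀ x {m z} → Positive ∣ x ∣ → m < ∣ z ÷' x ∣ → ∣ x ∣ * m < ∣ z ∣
∣x∣*m<∣z∣ x {m} {z} ∣x∣>0 m<∣z÷x∣ = begin-strict
  ∣ x ∣ * m               ≡⟨ *-comm ∣ x ∣ m ⟩
  m * ∣ x ∣               <⟨ *-monoˡ-<-pos ∣ x ∣ {{∣x∣>0}} m<∣z÷x∣ ⟩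
  ∣ z ÷' x ∣ * ∣ x ∣      ≡⟨ ∣p*q∣≡∣p∣*∣q∣ (z ÷' x) x ⟨
  ∣ z ÷' x * x ∣          ≡⟨ cong ∣_∣ (÷'-*-cancel z (∣p∣>0⇒p≢0 {x} ∣x∣>0)) ⟩
  ∣ z ∣                   ∎
  where open ≤-Reasoning

Between : ℚ → ℚ → ℚ → Set
Between a b c = (a ≤ b × b ≤ c) ⊎ (c ≤ b × b ≤ a)

between-0-or-± : ∀ {r t z} → ∣ r ∣ ≤ t → t ≤ ∣ z ∣ →
                 Between r 0ℚ z ⊎ Between r t z ⊎ Between r (- t) z
between-0-or-± {r} {t} {z} ∣r∣≤t t≤∣z∣ with ≤-total r 0ℚ | ≤-total z 0ℚ
... | inj₁ r≤0 | inj₂ 0≤z = inj₁ (inj₁ (r≤0 , 0≤z))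
... | inj₂ 0≤r | inj₁ z≤0 = inj₁ (inj₂ (z≤0 , 0≤r))
... | inj₂ 0≤r | inj₂ 0≤z = inj₂ (inj₁ (inj₁
  ( subst (_≤ t) (0≤p⇒∣p∣≡p 0≤r) ∣r∣≤t
  , subst (t ≤_) (0≤p⇒∣p∣≡p 0≤z) t≤∣z∣ )))
... | inj₁ r≤0 | inj₁ z≤0 = inj₂ (inj₂ (inj₂
  ( subst (_≤ - t) (p≤0⇒-∣p∣≡p z≤0) (neg-antimono-≤ t≤∣z∣)
  , subst (- t ≤_) (p≤0⇒-∣p∣≡p r≤0) (neg-antimono-≤ ∣r∣≤t) )))

infOf≢just-fin : ∀ s {a} → infOf s ≢ just (fin a)
infOf≢just-fin neg ()
infOf≢just-fin zer ()
infOf≢just-fin pos ()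

sign≡zer⇒≡0 : ∀ q → sign q ≡ zer → q ≡ 0ℚ
sign≡zer⇒≡0 q sign≡zer with q <? 0ℚ
sign≡zer⇒≡0 q ()       | yes _
sign≡zer⇒≡0 q sign≡zer | no _ with q ≟ 0ℚ
sign≡zer⇒≡0 q _        | no _ | yes q≡0 = q≡0
sign≡zer⇒≡0 q ()       | no _ | no _

≤̄-refl : ∀ a → a ≤̄ a
≤̄-refl -∞      = -∞≤
≤̄-refl (fin q) = fin≤ ≤-refl
≤̄-refl +∞      = ≤+∞

≤̄-antisym : ∀ {a b} → a ≤̄ b → b ≤̄ a → a ≡ b
≤̄-antisym -∞≤       -∞≤       = refl
≤̄-antisym ≤+∞       ≤+∞       = refl
≤̄-antisym (fin≤ a≤b) (fin≤ b≤a) = cong fin (≤-antisym a≤b b≤a)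

module FormatProperties (F : Format) where
  open Format F

  ulpExp : ℤ → ℤ
  ulpExp e = e ℤ.- + p ℤ.+ + 1

  maxMantissa : ℚ
  maxMantissa = (+ (β ℕ.^ p) ℤ.- + 1) / 1

  βpow-pos : ∀ k → Positive (βpow k)
  βpow-pos (+ n)    = normalize-pos (β ℕ.^ n) 1 {{_}} {{ℕP.m^n≢0 β n}}
  βpow-pos -[1+ n ] = normalize-pos 1 (β ℕ.^ suc n) {{ℕP.m^n≢0 β (suc n)}}

  βpow-mono-≤ : ∀ {k l} → k ℤ.≤ l → βpow k ≤ βpow l
  βpow-mono-≤ {+ a} {+ b} (ℤ.+≤+ a≤b) =
    +a/b≤+c/d (β ℕ.^ a) 1 (β ℕ.^ b) 1 (ℕP.*-monoˡ-≤ 1 (ℕP.^-monoʳ-≤ β a≤b))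
  βpow-mono-≤ { -[1+ a ]} {+ b} ℤ.-≤+ =
    +a/b≤+c/d 1 (β ℕ.^ suc a) (β ℕ.^ b) 1 {{ℕP.m^n≢0 β (suc a)}}
      (ℕP.*-mono-≤ (ℕP.m^n>0 β b) (ℕP.m^n>0 β (suc a)))
  βpow-mono-≤ { -[1+ a ]} { -[1+ b ]} (ℤ.-≤- b≤a) =
    +a/b≤+c/d 1 (β ℕ.^ suc a) 1 (β ℕ.^ suc b) {{ℕP.m^n≢0 β (suc a)}} {{ℕP.m^n≢0 β (suc b)}}
      (ℕP.*-monoʳ-≤ 1 (ℕP.^-monoʳ-≤ β (ℕ.s≤s b≤a)))

  ∣M*βpow∣ : ∀ M k → ∣ M / 1 * βpow k ∣ ≡ + ℤ.∣ M ∣ / 1 * βpow k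
  ∣M*βpow∣ M k = trans (∣p*q∣≡∣p∣*∣q∣ (M / 1) (βpow k))
    (cong₂ _*_ (∣i/1∣≡∣i∣/1 M) (0≤p⇒∣p∣≡p (<⇒≤ (positive⁻¹ (βpow k) {{βpow-pos k}}))))

  ·̄-attains-+∞ : ∀ {x} → x ≢ 0ℚ → Σ ℚ̄ λ w → IsF̄ w × fin x ·̄ w ≡ just +∞
  ·̄-attains-+∞ {x} x≢0 with sign x in eq
  ... | neg = -∞ , tt , cong (λ s → infOf (negS s)) eq
  ... | pos = +∞ , tt , cong infOf eq
  ... | zer = contradiction (sign≡zer⇒≡0 x eq) x≢0

  ·̄-attains--∞ : ∀ {x} → x ≢ 0ℚ → Σ ℚ̄ λ w → IsF̄ w × fin x ·̄ w ≡ just -∞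
  ·̄-attains--∞ {x} x≢0 with sign x in eq
  ... | neg = +∞ , tt , cong infOf eq
  ... | pos = -∞ , tt , cong (λ s → infOf (negS s)) eq
  ... | zer = contradiction (sign≡zer⇒≡0 x eq) x≢0

  ∣F*∣-pos : ∀ {x} → IsF* x → Positive ∣ x ∣
  ∣F*∣-pos (M , e , 0<∣M∣ , _ , _ , _ , refl) = subst Positive (sym (∣M*βpow∣ M k))
    (pos*pos⇒pos (+ ℤ.∣ M ∣ / 1) {{normalize-pos ℤ.∣ M ∣ 1 {{_}} {{ℕ.>-nonZero 0<∣M∣}}}}
                 (βpow k) {{βpow-pos k}})
    where k = ulpExp e

  mantissa≤maxMantissa : ∀ {m} → m ℕ.< β ℕ.^ p → + m / 1 ≤ maxMantissa
  mantissa≤maxMantissa {m} m<β^p = subst (λ i → + m / 1 ≤ i / 1) (sym (+n-+1≡+[n∸1] (ℕP.m^n>0 β p)))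
    (+a/b≤+c/d m 1 (β ℕ.^ p ∸ 1) 1 (ℕP.*-monoˡ-≤ 1 (ℕP.<⇒≤pred m<β^p)))

  maxMantissa-nonNeg : 0ℚ ≤ maxMantissa
  maxMantissa-nonNeg = mantissa≤maxMantissa (ℕP.m^n>0 β p)

  maxF-nonNeg : 0ℚ ≤ maxF
  maxF-nonNeg = nonNegative⁻¹ maxF
    {{nonNeg*nonNeg⇒nonNeg maxMantissa {{nonNegative maxMantissa-nonNeg}}
                           (βpow K) {{pos⇒nonNeg (βpow K) {{βpow-pos K}}}}}}
    where K = ulpExp emax

  ∣F∣≤maxF : ∀ {w} → IsF w → ∣ w ∣ ≤ maxF
  ∣F∣≤maxF (inj₂ refl) = maxF-nonNeg
  ∣F∣≤maxF (inj₁ (M , e , _ , ∣M∣<β^p , _ , e≤emax , refl)) = begin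
    ∣ M / 1 * βpow k ∣       ≡⟨ ∣M*βpow∣ M k ⟩
    + ℤ.∣ M ∣ / 1 * βpow k   ≤⟨ *-monoʳ-≤-nonNeg (βpow k) {{pos⇒nonNeg (βpow k) {{βpow-pos k}}}}
                                  (mantissa≤maxMantissa ∣M∣<β^p) ⟩
    maxMantissa * βpow k     ≤⟨ *-monoˡ-≤-nonNeg maxMantissa {{nonNegative maxMantissa-nonNeg}}
                                  (βpow-mono-≤ k≤K) ⟩
    maxMantissa * βpow K     ∎
    where
    open ≤-Reasoning
    k = ulpExp e
    K = ulpExp emax
    k≤K : k ℤ.≤ K
    k≤K = ℤP.+-monoˡ-≤ (+ 1) (ℤP.+-monoˡ-≤ (ℤ.- + p) e≤emax)

  F*-neg : ∀ {w} → IsF* w → IsF* (- w)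
  F*-neg (M , e , 0<∣M∣ , ∣M∣<β^p , emin≤e , e≤emax , refl) =
    ℤ.- M , e ,
    subst (0 ℕ.<_) (sym (ℤP.∣-i∣≡∣i∣ M)) 0<∣M∣ ,
    subst (ℕ._< β ℕ.^ p) (sym (ℤP.∣-i∣≡∣i∣ M)) ∣M∣<β^p ,
    emin≤e , e≤emax ,
    trans (neg-distribˡ-* (M / 1) _) (cong (_* _) (-[i/1]≡-i/1 M))

  F-neg : ∀ {w} → IsF w → IsF (- w)
  F-neg (inj₁ w∈F*) = inj₁ (F*-neg w∈F*)
  F-neg (inj₂ refl) = inj₂ refl

  *-attains-∣*∣ : ∀ x {w} → IsF w → Σ ℚ λ w′ → IsF w′ × x * w′ ≡ ∣ x * w ∣
  *-attains-∣*∣ x {w} w∈F with ∣p∣≡p∨∣p∣≡-p (x * w)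
  ... | inj₁ ∣xw∣≡xw  = w , w∈F , sym ∣xw∣≡xw
  ... | inj₂ ∣xw∣≡-xw = - w , F-neg w∈F , trans (sym (neg-distribʳ-* x w)) (sym ∣xw∣≡-xw)

  *-attains--∣*∣ : ∀ x {w} → IsF w → Σ ℚ λ w′ → IsF w′ × x * w′ ≡ - ∣ x * w ∣
  *-attains--∣*∣ x {w} w∈F with ∣p∣≡p∨∣p∣≡-p (x * w)
  ... | inj₁ ∣xw∣≡xw  = - w , F-neg w∈F , trans (sym (neg-distribʳ-* x w)) (cong -_ (sym ∣xw∣≡xw))
  ... | inj₂ ∣xw∣≡-xw = w , w∈F , trans (sym (neg-involutive _)) (cong -_ (sym ∣xw∣≡-xw))

  between-x*w′ : ∀ x {r w z} → IsF w → ∣ r ∣ ≤ ∣ x * w ∣ → ∣ x * w ∣ ≤ ∣ z ∣ →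
                 Σ ℚ λ w′ → IsF w′ × Between r (x * w′) z
  between-x*w′ x {r} {w} {z} w∈F ∣r∣≤∣xw∣ ∣xw∣≤∣z∣ =
    realise (between-0-or-± ∣r∣≤∣xw∣ ∣xw∣≤∣z∣)
    where
    Realisation = Σ ℚ λ w′ → IsF w′ × Between r (x * w′) z

    as-x*w′ : ∀ {b} → Σ ℚ (λ w′ → IsF w′ × x * w′ ≡ b) → Between r b z → Realisation
    as-x*w′ (w′ , w′∈F , xw′≡b) b-between =
      w′ , w′∈F , subst (λ b → Between r b z) (sym xw′≡b) b-between

    realise : Between r 0ℚ z ⊎ Between r ∣ x * w ∣ z ⊎ Between r (- ∣ x * w ∣) z → Realisation
    realise (inj₁ 0-between)           = as-x*w′ (0ℚ , inj₂ refl , *-zeroʳ x) 0-between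
    realise (inj₂ (inj₁ ∣xw∣-between))  = as-x*w′ (*-attains-∣*∣ x w∈F) ∣xw∣-between
    realise (inj₂ (inj₂ -∣xw∣-between)) = as-x*w′ (*-attains--∣*∣ x w∈F) -∣xw∣-between

module RoundingProperties (F : Format) {fl : ℚ̄ → ℚ̄} (R : Format.IsRounding F fl) where
  open Format F
  open FormatProperties F
  open IsRounding R

  fl-F̄ : ∀ a → IsF̄ (fl a)
  fl-F̄ a with faithful a
  ... | inj₁ (fl[a]∈F̄ , _) = fl[a]∈F̄
  ... | inj₂ (fl[a]∈F̄ , _) = fl[a]∈F̄

  fl-fixes-F̄ : ∀ {a} → IsF̄ a → fl a ≡ a
  fl-fixes-F̄ {a} a∈F̄ with faithful a
  ... | inj₁ (_ , fl[a]≤a , maximal) = ≤̄-antisym fl[a]≤a (maximal a a∈F̄ (≤̄-refl a))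
  ... | inj₂ (_ , a≤fl[a] , minimal) = ≤̄-antisym (minimal a a∈F̄ (≤̄-refl a)) a≤fl[a]

  fl-preimage-interval : ∀ {X} → IsInterval X → IsInterval (λ a → X (fl a))
  fl-preimage-interval X-interval a b c Xfl[a] Xfl[c] a≤b b≤c =
    X-interval _ _ _ Xfl[a] Xfl[c] (mono a b a≤b) (mono b c b≤c)

  fl-preimage-between : ∀ {X} → IsInterval X → ∀ {a b c} → Between a b c →
                        X (fl (fin a)) → X (fl (fin c)) → X (fl (fin b))
  fl-preimage-between X-interval (inj₁ (a≤b , b≤c)) Xfl[a] Xfl[c] =
    fl-preimage-interval X-interval _ _ _ Xfl[a] Xfl[c] (fin≤ a≤b) (fin≤ b≤c)
  fl-preimage-between X-interval (inj₂ (c≤b , b≤a)) Xfl[a] Xfl[c] =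
    fl-preimage-interval X-interval _ _ _ Xfl[c] Xfl[a] (fin≤ c≤b) (fin≤ b≤a)

  module Infeasible {X : ℚ̄ → Set} (X-interval : IsInterval X)
                    {x : ℚ} (x∈F* : IsF* x)
                    (x-infeasible : ¬ Feasible fl (FPInterval X) (fin x)) where

    x≢0 : x ≢ 0ℚ
    x≢0 = ∣p∣>0⇒p≢0 {x} (∣F*∣-pos x∈F*)

    ¬X-fl[x·w] : ∀ {w r} → IsF̄ w → fin x ·̄ w ≡ just r → ¬ X (fl r)
    ¬X-fl[x·w] w∈F̄ xw≡r Xfl[r] = x-infeasible (_ , w∈F̄ , _ , xw≡r , fl-F̄ _ , Xfl[r])

    ¬X-fl[+∞] : ¬ X (fl +∞)
    ¬X-fl[+∞] with ·̄-attains-+∞ x≢0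
    ... | _ , w∈F̄ , x·w≡+∞ = ¬X-fl[x·w] w∈F̄ x·w≡+∞

    ¬X-fl[-∞] : ¬ X (fl -∞)
    ¬X-fl[-∞] with ·̄-attains--∞ x≢0
    ... | _ , w∈F̄ , x·w≡-∞ = ¬X-fl[x·w] w∈F̄ x·w≡-∞

    ¬X-fl[x*w] : ∀ {w} → IsF w → ¬ X (fl (fin (x * w)))
    ¬X-fl[x*w] w∈F = ¬X-fl[x·w] w∈F refl

    ¬X-fl[y*w] : ∀ {y w z} → ∣ y ∣ ≤ ∣ x ∣ → IsF w → maxF < ∣ z ÷' x ∣ →
                 X (fl (fin z)) → ¬ X (fl (fin (y * w)))
    ¬X-fl[y*w] {y} {w} {z} ∣y∣≤∣x∣ w∈F maxF<∣z/x∣ Xfl[z] Xfl[yw] =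
      let w′ , w′∈F , x*w′-between = between-x*w′ x w∈F ∣yw∣≤∣xw∣ ∣xw∣≤∣z∣
      in ¬X-fl[x*w] w′∈F (fl-preimage-between X-interval x*w′-between Xfl[yw] Xfl[z])
      where
      open ≤-Reasoning
      ∣yw∣≤∣xw∣ : ∣ y * w ∣ ≤ ∣ x * w ∣
      ∣yw∣≤∣xw∣ = begin
        ∣ y * w ∣       ≡⟨ ∣p*q∣≡∣p∣*∣q∣ y w ⟩
        ∣ y ∣ * ∣ w ∣   ≤⟨ *-monoʳ-≤-nonNeg ∣ w ∣ {{∣-∣-nonNeg w}} ∣y∣≤∣x∣ ⟩
        ∣ x ∣ * ∣ w ∣   ≡⟨ ∣p*q∣≡∣p∣*∣q∣ x w ⟨
        ∣ x * w ∣       ∎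
      ∣xw∣≤∣z∣ : ∣ x * w ∣ ≤ ∣ z ∣
      ∣xw∣≤∣z∣ = begin
        ∣ x * w ∣       ≡⟨ ∣p*q∣≡∣p∣*∣q∣ x w ⟩
        ∣ x ∣ * ∣ w ∣   ≤⟨ *-monoˡ-≤-nonNeg ∣ x ∣ {{∣-∣-nonNeg x}} (∣F∣≤maxF w∈F) ⟩
        ∣ x ∣ * maxF    <⟨ ∣x∣*m<∣z∣ x (∣F*∣-pos x∈F*) maxF<∣z/x∣ ⟩
        ∣ z ∣           ∎

    ¬X-fl[y·w] : ∀ {y w r z} → ∣ y ∣ ≤ ∣ x ∣ → maxF < ∣ z ÷' x ∣ → X (fl (fin z)) →
                 IsF̄ w → fin y ·̄ w ≡ just r → ¬ X (fl r)
    ¬X-fl[y·w] {r = -∞} _ _ _ _ _ = ¬X-fl[-∞]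
    ¬X-fl[y·w] {r = +∞} _ _ _ _ _ = ¬X-fl[+∞]
    ¬X-fl[y·w] {y} { -∞} {fin _} _ _ _ _ y·w≡r = contradiction y·w≡r (infOf≢just-fin (negS (sign y)))
    ¬X-fl[y·w] {y} {+∞} {fin _} _ _ _ _ y·w≡r = contradiction y·w≡r (infOf≢just-fin (sign y))
    ¬X-fl[y·w] {w = fin _} {fin _} ∣y∣≤∣x∣ maxF<∣z/x∣ Xfl[z] w∈F refl =
      ¬X-fl[y*w] ∣y∣≤∣x∣ w∈F maxF<∣z/x∣ Xfl[z]

    finite-witness : ∀ {z} → FPInterval X z → fin maxF <̄ ∣ z /̄ x ∣̄ →
                     Σ ℚ λ z′ → maxF < ∣ z′ ÷' x ∣ × X (fl (fin z′))
    finite-witness { -∞} (_ , X[-∞]) _ = ⊥-elim (¬X-fl[-∞] (subst X (sym (fl-fixes-F̄ tt)) X[-∞]))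
    finite-witness {+∞}  (_ , X[+∞]) _ = ⊥-elim (¬X-fl[+∞] (subst X (sym (fl-fixes-F̄ tt)) X[+∞]))
    finite-witness {fin z} (z∈F , X[z]) (fin< maxF<∣z/x∣) =
      z , maxF<∣z/x∣ , subst X (sym (fl-fixes-F̄ z∈F)) X[z]

    y-infeasible : ∀ {y z} → ∣ y ∣ ≤ ∣ x ∣ → FPInterval X z → fin maxF <̄ ∣ z /̄ x ∣̄ →
                   ¬ Feasible fl (FPInterval X) (fin y)
    y-infeasible ∣y∣≤∣x∣ z∈Z maxF<∣z/x∣ (_ , w∈F̄ , _ , y·w≡r , _ , Xfl[r]) =
      let _ , maxF<∣z′/x∣ , Xfl[z′] = finite-witness z∈Z maxF<∣z/x∣
      in ¬X-fl[y·w] ∣y∣≤∣x∣ maxF<∣z′/x∣ Xfl[z′] w∈F̄ y·w≡r Xfl[r]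

mainTheorem18 : (F : Format) → let open Format F in
    (fl : ℚ̄ → ℚ̄) → IsRounding fl →
    (X : ℚ̄ → Set) → IsInterval X →
    (x y : ℚ) → IsF* x → IsF* y →
    (z : ℚ̄) → FPInterval X z →
    fin maxF <̄ ∣ z /̄ x ∣̄ →
    ¬ Feasible fl (FPInterval X) (fin x) →
    ∣ y ∣ ≤ ∣ x ∣ →
    ¬ Feasible fl (FPInterval X) (fin y)
mainTheorem18 F fl R X X-interval x y x∈F* _ z z∈Z maxF<∣z/x∣ x-infeasible ∣y∣≤∣x∣ =
  y-infeasible ∣y∣≤∣x∣ z∈Z maxF<∣z/x∣
  where
  open RoundingProperties F R
  open Infeasible X-interval x∈F* x-infeasible
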